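{- Let $n$ be a positive integer and let $F(t)=t^{2n}-a_{2n-1}t^{2n-1}-\cdots-a_0\in\mathbb{Z}[t]$. Suppose there exist $G(t),R(t)\in\mathbb{Z}[t]$ with $F(t)=(G(t))^2+R(t)$, where $G(t)=t^n-b_{n-1}t^{n-1}-\cdots-b_0$ and $R(t)=r_\ell t^\ell-r_{\ell-1}t^{\ell-1}-\cdots-r_0$ with $r_\ell\neq 0$ and $\ell<n$. Define $$Y_0=\begin{cases}\max\{m(G(t)),\,m(R(t)),\,m(2G(t)-R(t))\}, & \text{if } r_\ell>0,\\ \max\{m(G(t)),\,m(-R(t)),\,m(2G(t)+R(t)-1)\}, & \text{if } r_\ell<0.\end{cases}$$ Then the equation $X^2=F(Y)$ has no solutions in positive integers $X,Y$ with $Y\ge Y_0$.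
   Context: For a polynomial $P(t)\in\mathbb{Z}[t]$ with positive leading coefficient, $m(P(t))$ denotes the least positive integer $m$ such that $P(t)$ is a positive integer for every integer $t\ge m$. -}

module Defs where

open import Data.Nat as ℕ using (ℕ; suc)
open import Data.Integer using (ℤ; +_; -_; _+_; _*_; _<_; 0ℤ; 1ℤ)
open import Data.List using (List; []; _∷_; map; foldr; _++_; [_])
open import Data.Fin using (Fin)
open import Data.List.Base using (tabulate)
open import Data.Product using (_×_)
open import Relation.Binary.PropositionalEquality using (_≡_)

-- Polynomials in ℤ[t] as coefficient lists, lowest degree first.
Poly : Set
Poly = List ℤ

coeff : Poly → ℕ → ℤ
coeff []       _       = 0ℤ
coeff (c ∷ p)  ℕ.zero  = c
coeff (c ∷ p)  (suc i) = coeff p i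

_≈P_ : Poly → Poly → Set
p ≈P q = ∀ i → coeff p i ≡ coeff q i

infixl 6 _+P_
infixl 7 _*P_

_+P_ : Poly → Poly → Poly
[]      +P q       = q
(c ∷ p) +P []      = c ∷ p
(c ∷ p) +P (d ∷ q) = (c + d) ∷ (p +P q)

scale : ℤ → Poly → Poly
scale k p = map (k *_) p

_*P_ : Poly → Poly → Poly
[]      *P q = []
(c ∷ p) *P q = scale c q +P (0ℤ ∷ (p *P q))

eval : Poly → ℤ → ℤ
eval p t = foldr (λ c acc → c + t * acc) 0ℤ p

monicMinus : (d : ℕ) → (Fin d → ℤ) → Poly
monicMinus d c = tabulate (λ i → - c i) ++ [ 1ℤ ]

leadMinus : (ℓ : ℕ) → ℤ → (Fin ℓ → ℤ) → Poly
leadMinus ℓ rℓ r = tabulate (λ i → - r i) ++ [ rℓ ]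

PosFrom : Poly → ℕ → Set
PosFrom P m = ∀ (t : ℕ) → m ℕ.≤ t → 0ℤ < eval P (+ t)

IsM : Poly → ℕ → Set
IsM P m = (1 ℕ.≤ m) × PosFrom P m × (∀ m' → 1 ℕ.≤ m' → PosFrom P m' → m ℕ.≤ m')

-- X² = G(Y)² + R(Y) with Y beyond the thresholds puts X² strictly between two consecutive squares:
-- if r_ℓ > 0 then 0 < R(Y) < 2G(Y), so G(Y)² < X² < (G(Y)+1)²; if r_ℓ < 0 then 0 < −R(Y) < 2G(Y) − 1,
-- so (G(Y)−1)² < X² < G(Y)². The thresholds themselves exist because G, ±R and the two comparison
-- polynomials all have positive leading coefficient, hence are eventually positive.
module Submission where

open import Defs
open import Data.Product using (Σ; Σ-syntax; _,_; _×_)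
open import Data.Empty using (⊥)
open import Relation.Binary.PropositionalEquality
  using (_≡_; _≢_; refl; sym; trans; cong; cong₂; subst; subst₂; module ≡-Reasoning)

module SquaresBetweenSquares where
  open import Data.Nat as ℕ using (suc; z<s)
  open import Data.Nat.Properties using (_≤?_; <⇒≱; *-mono-≤; ≰⇒>)
  open import Data.Integer using (ℤ; +_; +[1+_]; _+_; _*_; _<_; _≤_; 0ℤ; 1ℤ; -1ℤ; +<+)
  open import Data.Integer.Properties using (+-identityʳ; +-monoʳ-<; <-trans; drop‿+<+; pos-*)
  open import Data.Integer.Tactic.RingSolver using (solve-∀)
  open import Relation.Nullary using (yes; no)

  no-square-strictly-between : ∀ X H → H ℕ.* H ℕ.< X ℕ.* X → X ℕ.* X ℕ.< suc H ℕ.* suc H → ⊥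
  no-square-strictly-between X H H²<X² X²<[1+H]² with X ≤? H
  ... | yes X≤H = <⇒≱ H²<X² (*-mono-≤ X≤H X≤H)
  ... | no X≰H  = <⇒≱ X²<[1+H]² (*-mono-≤ (≰⇒> X≰H) (≰⇒> X≰H))

  no-square-strictly-betweenℤ : ∀ X H → + H * + H < + X * + X → + X * + X < +[1+ H ] * +[1+ H ] → ⊥
  no-square-strictly-betweenℤ X H lower upper = no-square-strictly-between X H
    (drop‿+<+ (subst₂ _<_ (sym (pos-* H H)) (sym (pos-* X X)) lower))
    (drop‿+<+ (subst₂ _<_ (sym (pos-* X X)) (sym (pos-* (suc H) (suc H))) upper))

  i<i+j : ∀ i {j} → 0ℤ < j → i < i + j
  i<i+j i 0<j = subst (_< i + _) (+-identityʳ i) (+-monoʳ-< i 0<j)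

  square≢slightly-above-square : ∀ X g ρ → 0ℤ ≤ g → 0ℤ < ρ → 0ℤ < + 2 * g + -1ℤ * ρ
    → + X * + X ≢ g * g + ρ
  square≢slightly-above-square X (+ G) ρ _ 0<ρ 0<2g-ρ X²≡g²+ρ = no-square-strictly-betweenℤ X G
    (subst (+ G * + G <_) (sym X²≡g²+ρ) (i<i+j _ 0<ρ))
    (subst₂ _<_ (sym X²≡g²+ρ) (expand (+ G) ρ) (i<i+j _ (<-trans 0<2g-ρ (i<i+j _ (+<+ z<s)))))
    where
    expand : ∀ g ρ → (g * g + ρ) + ((+ 2 * g + -1ℤ * ρ) + 1ℤ) ≡ (1ℤ + g) * (1ℤ + g)
    expand = solve-∀

  square≢slightly-below-square : ∀ X g ρ → 0ℤ < g → 0ℤ < -1ℤ * ρ → 0ℤ < (+ 2 * g + ρ) + -1ℤ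
    → + X * + X ≢ g * g + ρ
  square≢slightly-below-square X (+ 0) ρ (+<+ ())
  square≢slightly-below-square X +[1+ H ] ρ _ 0<-ρ 0<2g+ρ-1 X²≡g²+ρ = no-square-strictly-betweenℤ X H
    (subst (+ H * + H <_) (trans (expand (+ H) ρ) (sym X²≡g²+ρ)) (i<i+j _ 0<2g+ρ-1))
    (subst₂ _<_ (sym X²≡g²+ρ) (cancel +[1+ H ] ρ) (i<i+j _ 0<-ρ))
    where
    expand : ∀ h ρ → h * h + ((+ 2 * (1ℤ + h) + ρ) + -1ℤ) ≡ (1ℤ + h) * (1ℤ + h) + ρ
    expand = solve-∀
    cancel : ∀ g ρ → (g * g + ρ) + -1ℤ * ρ ≡ g * g
    cancel = solve-∀

module Polynomials where
  open import Data.Nat as ℕ using (ℕ; zero; suc; z≤n; s≤s; _⊔_)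
  open import Data.Nat.Properties as ℕ using (m⊔n≤o⇒m≤o; m⊔n≤o⇒n≤o)
  open import Data.Integer using (ℤ; +_; +[1+_]; -[1+_]; ∣_∣; _+_; _*_; _<_; 0ℤ; 1ℤ; +<+)
  open import Data.Integer.Properties using (_<?_; ⊖-≥; pos-*; +-identityˡ; +-identityʳ; *-zeroˡ; *-zeroʳ)
  open import Data.Integer.Tactic.RingSolver using (solve-∀)
  open import Data.List using (List; []; _∷_; [_]; _++_; map; length)
  open import Data.List.Properties using (length-++; length-map; length-tabulate; map-++)
  open import Data.Sum using (inj₁; inj₂)
  open import Relation.Nullary using (yes; no)

  eval-+P : ∀ p q t → eval (p +P q) t ≡ eval p t + eval q t
  eval-+P []      q       t = sym (+-identityˡ _)
  eval-+P (c ∷ p) []      t = sym (+-identityʳ _)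
  eval-+P (c ∷ p) (d ∷ q) t =
    trans (cong (λ s → (c + d) + t * s) (eval-+P p q t)) (regroup c d t (eval p t) (eval q t))
    where
    regroup : ∀ c d t x y → (c + d) + t * (x + y) ≡ (c + t * x) + (d + t * y)
    regroup = solve-∀

  eval-scale : ∀ k p t → eval (scale k p) t ≡ k * eval p t
  eval-scale k []      t = sym (*-zeroʳ k)
  eval-scale k (c ∷ p) t = trans (cong (λ s → k * c + t * s) (eval-scale k p t)) (factor k c t (eval p t))
    where
    factor : ∀ k c t x → k * c + t * (k * x) ≡ k * (c + t * x)
    factor = solve-∀

  eval-*P : ∀ p q t → eval (p *P q) t ≡ eval p t * eval q t
  eval-*P []      q t = sym (*-zeroˡ (eval q t))
  eval-*P (c ∷ p) q t = begin
    eval (scale c q +P (0ℤ ∷ p *P q)) t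
      ≡⟨ eval-+P (scale c q) (0ℤ ∷ p *P q) t ⟩
    eval (scale c q) t + (0ℤ + t * eval (p *P q) t)
      ≡⟨ cong₂ (λ a b → a + (0ℤ + t * b)) (eval-scale c q t) (eval-*P p q t) ⟩
    c * eval q t + (0ℤ + t * (eval p t * eval q t))
      ≡⟨ factor c t (eval p t) (eval q t) ⟩
    (c + t * eval p t) * eval q t ∎
    where
    open ≡-Reasoning
    factor : ∀ c t x y → c * y + (0ℤ + t * (x * y)) ≡ (c + t * x) * y
    factor = solve-∀

  eval-[c] : ∀ c t → eval [ c ] t ≡ c
  eval-[c] c t = trans (cong (λ s → c + s) (*-zeroʳ t)) (+-identityʳ c)

  eval-≈P-zero : ∀ q t → [] ≈P q → eval q t ≡ 0ℤ
  eval-≈P-zero []      t _    = refl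
  eval-≈P-zero (d ∷ q) t []≈q = trans
    (cong₂ (λ a b → a + t * b) (sym ([]≈q 0)) (eval-≈P-zero q t (λ i → []≈q (suc i))))
    (cong (λ s → 0ℤ + s) (*-zeroʳ t))

  eval-cong : ∀ p q t → p ≈P q → eval p t ≡ eval q t
  eval-cong []      q       t p≈q = sym (eval-≈P-zero q t p≈q)
  eval-cong (c ∷ p) []      t p≈q = eval-≈P-zero (c ∷ p) t (λ i → sym (p≈q i))
  eval-cong (c ∷ p) (d ∷ q) t p≈q =
    cong₂ (λ a b → a + t * b) (p≈q 0) (eval-cong p q t (λ i → p≈q (suc i)))

  length-+P : ∀ xs ys → length ys ℕ.≤ length xs → length (xs +P ys) ≡ length xs
  length-+P []       []       _         = refl
  length-+P (x ∷ xs) []       _         = refl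
  length-+P (x ∷ xs) (y ∷ ys) (s≤s ys≤xs) = cong suc (length-+P xs ys ys≤xs)

  ++-+P : ∀ xs c ys → length ys ℕ.≤ length xs → (xs ++ [ c ]) +P ys ≡ (xs +P ys) ++ [ c ]
  ++-+P []       c []       _           = refl
  ++-+P (x ∷ xs) c []       _           = refl
  ++-+P (x ∷ xs) c (y ∷ ys) (s≤s ys≤xs) = cong ((x + y) ∷_) (++-+P xs c ys ys≤xs)

  HasLeadingTerm : ℤ → ℕ → Poly → Set
  HasLeadingTerm c d P = Σ[ cs ∈ Poly ] length cs ≡ d × P ≡ cs ++ [ c ]

  monicMinus-leading : ∀ d c → HasLeadingTerm 1ℤ d (monicMinus d c)
  monicMinus-leading d c = _ , length-tabulate _ , refl

  leadMinus-leading : ∀ ℓ rℓ r → HasLeadingTerm rℓ ℓ (leadMinus ℓ rℓ r)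
  leadMinus-leading ℓ rℓ r = _ , length-tabulate _ , refl

  length-leading : ∀ {c d P} → HasLeadingTerm c d P → length P ≡ suc d
  length-leading {c} (cs , refl , refl) = trans (length-++ cs) (ℕ.+-comm (length cs) 1)

  scale-leading : ∀ k {c d P} → HasLeadingTerm c d P → HasLeadingTerm (k * c) d (scale k P)
  scale-leading k {c} (cs , refl , refl) = map (k *_) cs , length-map _ cs , map-++ _ cs [ c ]

  +P-leading : ∀ {c d P Q} → HasLeadingTerm c d P → length Q ℕ.≤ d → HasLeadingTerm c d (P +P Q)
  +P-leading {c} {Q = Q} (cs , refl , refl) Q≤d = cs +P Q , length-+P cs Q Q≤d , ++-+P cs c Q Q≤d

  0<i+m : ∀ i {m} → ∣ i ∣ ℕ.< m → 0ℤ < i + + m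
  0<i+m (+ n)    ∣i∣<m = +<+ (ℕ.<-≤-trans (ℕ.≤-<-trans z≤n ∣i∣<m) (ℕ.m≤n+m _ n))
  0<i+m -[1+ n ] ∣i∣<m rewrite ⊖-≥ (ℕ.<⇒≤ ∣i∣<m) = +<+ (ℕ.m<n⇒0<n∸m ∣i∣<m)

  0<i+m*j : ∀ i m {j} → 0ℤ < j → ∣ i ∣ ℕ.< m → 0ℤ < i + + m * j
  0<i+m*j i m {+ 0}      (+<+ ())
  0<i+m*j i m {+[1+ k ]} _ ∣i∣<m rewrite sym (pos-* m (suc k)) =
    0<i+m i (ℕ.<-≤-trans ∣i∣<m (ℕ.m≤m*n m (suc k)))

  PosFrom-++ : ∀ cs {c} → 0ℤ < c → Σ ℕ (PosFrom (cs ++ [ c ]))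
  PosFrom-++ []       {c} 0<c = 0 , λ t _ → subst (0ℤ <_) (sym (eval-[c] c (+ t))) 0<c
  PosFrom-++ (d ∷ cs) 0<c with PosFrom-++ cs 0<c
  ... | B , pos = B ⊔ suc ∣ d ∣ , λ t B⊔≤t →
    0<i+m*j d t (pos t (m⊔n≤o⇒m≤o B _ B⊔≤t)) (m⊔n≤o⇒n≤o B _ B⊔≤t)

  PosFrom-pred : ∀ P {k} → PosFrom P (suc k) → 0ℤ < eval P (+ k) → PosFrom P k
  PosFrom-pred P pos P[k]>0 t k≤t with ℕ.m≤n⇒m<n∨m≡n k≤t
  ... | inj₁ k<t  = pos t k<t
  ... | inj₂ refl = P[k]>0

  IsM-exists-below : ∀ P k → PosFrom P (suc k) → Σ ℕ (IsM P)
  IsM-exists-below P zero    pos = 1 , s≤s z≤n , pos , λ _ 1≤m _ → 1≤m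
  IsM-exists-below P (suc k) pos with 0ℤ <? eval P (+ suc k)
  ... | yes P[1+k]>0 = IsM-exists-below P k (PosFrom-pred P pos P[1+k]>0)
  ... | no  P[1+k]≯0 = suc (suc k) , s≤s z≤n , pos ,
    λ m _ posₘ → ℕ.≮⇒≥ (λ m<2+k → P[1+k]≯0 (posₘ (suc k) (ℕ.≤-pred m<2+k)))

  leading-positive⇒IsM : ∀ {c d P} → 0ℤ < c → HasLeadingTerm c d P → Σ ℕ (IsM P)
  leading-positive⇒IsM 0<c (cs , _ , refl) with PosFrom-++ cs 0<c
  ... | B , pos = IsM-exists-below (cs ++ [ _ ]) B (λ t B<t → pos t (ℕ.<⇒≤ B<t))

  eval-square-plus : ∀ F G R t → F ≈P (G *P G +P R) → eval F t ≡ eval G t * eval G t + eval R t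
  eval-square-plus F G R t F≈G²+R =
    trans (eval-cong F (G *P G +P R) t F≈G²+R)
      (trans (eval-+P (G *P G) R t) (cong (_+ eval R t) (eval-*P G G t)))

  positive-beyond-⊔ : ∀ P Q S {mP mQ mS Y} → IsM P mP → IsM Q mQ → IsM S mS → mP ⊔ mQ ⊔ mS ℕ.≤ Y
    → 0ℤ < eval P (+ Y) × 0ℤ < eval Q (+ Y) × 0ℤ < eval S (+ Y)
  positive-beyond-⊔ P Q S {mP} {mQ} {mS} (_ , posP , _) (_ , posQ , _) (_ , posS , _) ⊔≤Y =
    posP _ (m⊔n≤o⇒m≤o mP mQ ⊔₂≤Y) , posQ _ (m⊔n≤o⇒n≤o mP mQ ⊔₂≤Y) ,
    posS _ (m⊔n≤o⇒n≤o (mP ⊔ mQ) mS ⊔≤Y)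
    where
    ⊔₂≤Y = m⊔n≤o⇒m≤o (mP ⊔ mQ) mS ⊔≤Y

module NoSquareBeyondThresholds where
  open import Data.Nat as ℕ using (ℕ; z≤n; s≤s; _⊔_)
  import Data.Nat.Properties as ℕ
  open import Data.Integer using (ℤ; +_; _+_; _*_; _<_; 0ℤ; 1ℤ; -1ℤ; +<+)
  open import Data.Integer.Properties using (<⇒≤; neg-mono-<; -1*i≡-i)
  open import Data.List using ([_]; length)
  open import Data.List.Properties using (length-map)
  open import Relation.Nullary using (¬_)
  open SquaresBetweenSquares
  open Polynomials

  module Solution {n ℓ : ℕ} {rℓ : ℤ} {G R : Poly}
    (G-monic : HasLeadingTerm 1ℤ n G) (R-leading : HasLeadingTerm rℓ ℓ R) (ℓ<n : ℓ ℕ.< n)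
    (X Y : ℕ) (X²≡G²+R : + X * + X ≡ eval G (+ Y) * eval G (+ Y) + eval R (+ Y)) where

    MaxOfThresholds : Poly → Poly → Poly → ℕ → Set
    MaxOfThresholds P Q S Y₀ = ∀ mP mQ mS → IsM P mP → IsM Q mQ → IsM S mS → Y₀ ≡ mP ⊔ mQ ⊔ mS

    private
      t = + Y
      g = eval G t
      ρ = eval R t

      R≤n : length R ℕ.≤ n
      R≤n = subst (ℕ._≤ n) (sym (length-leading R-leading)) ℓ<n

    no-solution-if-rℓ>0 : 0ℤ < rℓ → ∀ {Y₀} → MaxOfThresholds G R (scale (+ 2) G +P scale -1ℤ R) Y₀
      → ¬ Y₀ ℕ.≤ Y
    no-solution-if-rℓ>0 0<rℓ Y₀≡ Y₀≤Y =
      let (mG , G-isM) = leading-positive⇒IsM (+<+ (s≤s z≤n)) G-monic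
          (mR , R-isM) = leading-positive⇒IsM 0<rℓ R-leading
          (mS , S-isM) = leading-positive⇒IsM (+<+ (s≤s z≤n))
                           (+P-leading (scale-leading (+ 2) G-monic) -R≤n)
          (G>0 , R>0 , S>0) = positive-beyond-⊔ G R S G-isM R-isM S-isM
                                (subst (ℕ._≤ Y) (Y₀≡ mG mR mS G-isM R-isM S-isM) Y₀≤Y)
      in square≢slightly-above-square X g ρ (<⇒≤ G>0) R>0 (subst (0ℤ <_) eval-S S>0) X²≡G²+R
      where
      S = scale (+ 2) G +P scale -1ℤ R
      -R≤n : length (scale -1ℤ R) ℕ.≤ n
      -R≤n = subst (ℕ._≤ n) (sym (length-map _ R)) R≤n
      eval-S : eval S t ≡ + 2 * g + -1ℤ * ρ
      eval-S = trans (eval-+P (scale (+ 2) G) (scale -1ℤ R) t)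
        (cong₂ _+_ (eval-scale (+ 2) G t) (eval-scale -1ℤ R t))

    no-solution-if-rℓ<0 : rℓ < 0ℤ → ∀ {Y₀} → MaxOfThresholds G (scale -1ℤ R) (scale (+ 2) G +P R +P [ -1ℤ ]) Y₀
      → ¬ Y₀ ℕ.≤ Y
    no-solution-if-rℓ<0 rℓ<0 Y₀≡ Y₀≤Y =
      let (mG , G-isM) = leading-positive⇒IsM (+<+ (s≤s z≤n)) G-monic
          (mR , R-isM) = leading-positive⇒IsM 0<-rℓ (scale-leading -1ℤ R-leading)
          (mS , S-isM) = leading-positive⇒IsM (+<+ (s≤s z≤n))
                           (+P-leading (+P-leading (scale-leading (+ 2) G-monic) R≤n) 1≤n)
          (G>0 , -R>0 , S>0) = positive-beyond-⊔ G (scale -1ℤ R) S G-isM R-isM S-isM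
                                (subst (ℕ._≤ Y) (Y₀≡ mG mR mS G-isM R-isM S-isM) Y₀≤Y)
      in square≢slightly-below-square X g ρ G>0 (subst (0ℤ <_) (eval-scale -1ℤ R t) -R>0)
           (subst (0ℤ <_) eval-S S>0) X²≡G²+R
      where
      S = scale (+ 2) G +P R +P [ -1ℤ ]
      0<-rℓ : 0ℤ < -1ℤ * rℓ
      0<-rℓ = subst (0ℤ <_) (sym (-1*i≡-i rℓ)) (neg-mono-< rℓ<0)
      1≤n : 1 ℕ.≤ n
      1≤n = ℕ.≤-trans (s≤s z≤n) ℓ<n
      eval-S : eval S t ≡ (+ 2 * g + ρ) + -1ℤ
      eval-S = trans (eval-+P (scale (+ 2) G +P R) [ -1ℤ ] t)
        (cong₂ _+_ (trans (eval-+P (scale (+ 2) G) R t) (cong (_+ ρ) (eval-scale (+ 2) G t))) (eval-[c] -1ℤ t))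

open import Data.Nat using (ℕ; _<_; _≤_; _⊔_; _*_)
open import Data.Integer using (ℤ; +_; 0ℤ; -1ℤ) renaming (_<_ to _<ℤ_; _*_ to _*ℤ_)
open import Data.Fin using (Fin)
open import Data.List using ([_])
open import Data.Integer.Properties using (<-cmp)
open import Relation.Binary.Definitions using (Tri; tri<; tri≈; tri>)
open Polynomials
open NoSquareBeyondThresholds

lemma2p2 : (n : ℕ) → 1 ≤ n → (a : Fin (2 * n) → ℤ) → (b : Fin n → ℤ)
    → (ℓ : ℕ) → ℓ < n → (rℓ : ℤ) → (r : Fin ℓ → ℤ) → rℓ ≢ 0ℤ
    → monicMinus (2 * n) a ≈P (monicMinus n b *P monicMinus n b +P leadMinus ℓ rℓ r)
    → (Y₀ : ℕ)
    → ((0ℤ <ℤ rℓ → (mG mR mS : ℕ) → IsM (monicMinus n b) mG → IsM (leadMinus ℓ rℓ r) mR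
          → IsM (scale (+ 2) (monicMinus n b) +P scale -1ℤ (leadMinus ℓ rℓ r)) mS
          → Y₀ ≡ mG ⊔ mR ⊔ mS)
       × (rℓ <ℤ 0ℤ → (mG mR mS : ℕ) → IsM (monicMinus n b) mG → IsM (scale -1ℤ (leadMinus ℓ rℓ r)) mR
          → IsM (scale (+ 2) (monicMinus n b) +P leadMinus ℓ rℓ r +P [ -1ℤ ]) mS
          → Y₀ ≡ mG ⊔ mR ⊔ mS))
    → (X Y : ℕ) → 1 ≤ X → 1 ≤ Y → Y₀ ≤ Y
    → (+ X) *ℤ (+ X) ≢ eval (monicMinus (2 * n) a) (+ Y)
lemma2p2 n _ a b ℓ ℓ<n rℓ r rℓ≢0 F≈G²+R Y₀ (Y₀-if-rℓ>0 , Y₀-if-rℓ<0) X Y _ _ Y₀≤Y X²≡F =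
  by-sign (<-cmp 0ℤ rℓ)
  where
  open Solution (monicMinus-leading n b) (leadMinus-leading ℓ rℓ r) ℓ<n X Y
    (trans X²≡F (eval-square-plus (monicMinus (2 * n) a) (monicMinus n b) (leadMinus ℓ rℓ r) (+ Y)
      F≈G²+R))

  by-sign : Tri (0ℤ <ℤ rℓ) (0ℤ ≡ rℓ) (rℓ <ℤ 0ℤ) → ⊥
  by-sign (tri< 0<rℓ _ _) = no-solution-if-rℓ>0 0<rℓ (Y₀-if-rℓ>0 0<rℓ) Y₀≤Y
  by-sign (tri≈ _ 0≡rℓ _) = rℓ≢0 (sym 0≡rℓ)
  by-sign (tri> _ _ rℓ<0) = no-solution-if-rℓ<0 rℓ<0 (Y₀-if-rℓ<0 rℓ<0) Y₀≤Y
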